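{- Let $\mathcal{C}=\{C_1,\dots,C_k\}$ be a set of vertex-disjoint cycles (in a complete graph) and let $f_1\in E(\mathcal{C})$ and $f_2\notin E(\mathcal{C})$ be disjoint edges (sharing no vertex). Then $(E(\mathcal{C}) \setminus\{f_1\})\cup \{f_2\}$ can be odd-covered using 2 paths.
   Context: Graphs are simple; cycles have at least three vertices. $E(\mathcal C)=\bigcup_i E(C_i)$. A set $F$ of edges of a complete graph is odd-covered by paths $P_1,\dots,P_m$ of that complete graph if $E(P_1)\oplus\cdots\oplus E(P_m)=F$, where $\oplus$ denotes symmetric difference. -}

module Defs where

open import Data.Nat using (ℕ; _≤_)
open import Data.Fin using (Fin; _≟_)
open import Data.Bool using (Bool; true; false; _∨_; _∧_; if_then_else_)
open import Data.List using (List; []; _∷_; _++_; length; concat)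
open import Data.List.Relation.Unary.Unique.Propositional using (Unique)
open import Data.List.Relation.Unary.All using (All)
open import Data.Product using (_×_)
open import Relation.Nullary.Decidable using (⌊_⌋)

-- Vertices of the complete graph K_n are Fin n; an edge is an unordered
-- pair {u , v} with u ≢ v.  Edge sets are Bool-valued predicates on
-- (ordered representatives of) pairs.

sameEdge : ∀ {n} → Fin n → Fin n → Fin n → Fin n → Bool
sameEdge u v a b = (⌊ u ≟ a ⌋ ∧ ⌊ v ≟ b ⌋) ∨ (⌊ u ≟ b ⌋ ∧ ⌊ v ≟ a ⌋)

pathHasEdge : ∀ {n} → List (Fin n) → Fin n → Fin n → Bool
pathHasEdge [] u v = false
pathHasEdge (x ∷ []) u v = false
pathHasEdge (x ∷ y ∷ xs) u v = sameEdge u v x y ∨ pathHasEdge (y ∷ xs) u v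

IsPath : ∀ {n} → List (Fin n) → Set
IsPath P = Unique P × 1 ≤ length P

cycleHasEdge : ∀ {n} → List (Fin n) → Fin n → Fin n → Bool
cycleHasEdge [] u v = false
cycleHasEdge (x ∷ xs) u v = pathHasEdge ((x ∷ xs) ++ (x ∷ [])) u v

IsCycle : ∀ {n} → List (Fin n) → Set
IsCycle C = Unique C × 3 ≤ length C

VertexDisjointCycles : ∀ {n} → List (List (Fin n)) → Set
VertexDisjointCycles Cs = All IsCycle Cs × Unique (concat Cs)

cyclesHaveEdge : ∀ {n} → List (List (Fin n)) → Fin n → Fin n → Bool
cyclesHaveEdge [] u v = false
cyclesHaveEdge (C ∷ Cs) u v = cycleHasEdge C u v ∨ cyclesHaveEdge Cs u v

swapEdges : ∀ {n} → List (List (Fin n)) → Fin n → Fin n → Fin n → Fin n →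
            Fin n → Fin n → Bool
swapEdges Cs a b c d u v =
  if sameEdge u v a b then false
  else (if sameEdge u v c d then true else cyclesHaveEdge Cs u v)

-- Deleting ab from its cycle leaves a path Q from b to a, so mod 2 the target edge set is
-- E(Q) ⊕ E(R) ⊕ {cd}, where R are the other cycles. Two walks absorb the cycles of R: x, C₁, C₂, …
-- threading through all their vertices, and x, h₁, ℓ₁, h₂, ℓ₂, … jumping from the first vertex hᵢ
-- to the last vertex ℓᵢ of each cycle; they differ by exactly E(R). Hooking the two walks onto Q
-- and cd onto one of them gives the two paths. How depends on where c and d lie: a vertex on a cycle
-- of R becomes the first vertex of that cycle, a vertex d on Q cuts Q into b…p, d…a, whose second
-- piece is then run backwards, and a vertex outside Q ∪ R is simply prepended. The cycles are
-- rotated so that d is never a jump endpoint; cd ∉ E(𝒞) excludes the remaining collisions.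

module Submission where

open import Defs
open import Data.Nat using (ℕ; _≤_; s≤s; z≤n)
open import Data.Fin using (Fin; _≟_)
open import Data.Bool using (Bool; true; false; _xor_; _∨_; _∧_)
open import Data.Bool.Properties
  using (∨-comm; ∧-comm; ∨-assoc; ∨-identityʳ; ∨-zeroʳ; xor-assoc; xor-comm; xor-identityʳ; ¬-not)
import Data.Bool.Solver as BoolSolver
open import Data.List using (List; []; _∷_; _++_; [_]; concat; reverse)
open import Data.List.Properties using (++-assoc; ++-identityʳ; unfold-reverse)
open import Data.List.Membership.Propositional using (_∈_; _∉_)
open import Data.List.Membership.Propositional.Properties
  using (∈-++⁻; ∈-++⁺ˡ; ∈-++⁺ʳ; ∈-∃++; ∈-concat⁻′)
import Data.List.Membership.DecPropositional as DecMembership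
open import Data.List.Relation.Unary.Any using (here; there)
open import Data.List.Relation.Unary.All using (All; []; _∷_)
import Data.List.Relation.Unary.All.Properties as All
open import Data.List.Relation.Unary.AllPairs using ([]; _∷_)
open import Data.List.Relation.Unary.Unique.Propositional using (Unique)
import Data.List.Relation.Unary.Unique.Propositional.Properties as Unique
open import Data.List.Relation.Binary.Disjoint.Propositional using (Disjoint)
import Data.List.Relation.Binary.Permutation.Propositional as ↭
open ↭ using (_↭_; ↭-refl; ↭-sym; ↭-trans; ↭-reflexive; prep; ↭⇒↭ₛ)
open import Data.List.Relation.Binary.Permutation.Propositional.Properties
  using (↭-length; ∈-resp-↭; ++⁺; ++⁺ˡ; ++⁺ʳ; ++-comm; shifts; shift; ↭-reverse)
import Data.List.Relation.Binary.Permutation.Setoid.Properties as PermutationSetoid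
open import Data.Product using (_×_; _,_; proj₁; proj₂; ∃; ∃₂; map)
open import Data.Sum using (_⊎_; inj₁; inj₂; [_,_]′)
open import Data.Empty using (⊥; ⊥-elim)
open import Function using (_∘_)
open import Relation.Nullary using (Dec; ¬_; yes; no; contradiction)
open import Relation.Nullary.Decidable using (⌊_⌋; dec-true; dec-false; isYes≗does)
open import Relation.Binary.PropositionalEquality
  using (_≡_; _≢_; refl; sym; trans; cong; cong₂; subst; setoid; module ≡-Reasoning)

open BoolSolver.xor-∧-Solver using (solve; _:=_; _:+_)

variable
  n : ℕ
  A : Set

xor≡true⇒ : ∀ x y → x xor y ≡ true → x ≡ true ⊎ y ≡ true
xor≡true⇒ true  _ _ = inj₁ refl
xor≡true⇒ false _ p = inj₂ p

∨≡true⇒ : ∀ x y → x ∨ y ≡ true → x ≡ true ⊎ y ≡ true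
∨≡true⇒ true  _ _ = inj₁ refl
∨≡true⇒ false _ p = inj₂ p

∨≡xor : ∀ x y → (x ≡ true → y ≡ true → ⊥) → x ∨ y ≡ x xor y
∨≡xor false _     _ = refl
∨≡xor true  false _ = refl
∨≡xor true  true  h = ⊥-elim (h refl refl)

⌊⌋-true : {P : Set} (p? : Dec P) → P → ⌊ p? ⌋ ≡ true
⌊⌋-true p? p = trans (isYes≗does p?) (dec-true p? p)

⌊⌋-false : {P : Set} (p? : Dec P) → ¬ P → ⌊ p? ⌋ ≡ false
⌊⌋-false p? ¬p = trans (isYes≗does p?) (dec-false p? ¬p)

unique-∷ : {x : A} {xs : List A} → x ∉ xs → Unique xs → Unique (x ∷ xs)
unique-∷ {xs = xs} x∉ u = All.¬Any⇒All¬ xs x∉ ∷ u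

unique-++⁻ : (xs : List A) {ys : List A} → Unique (xs ++ ys) →
             Unique xs × Unique ys × Disjoint xs ys
unique-++⁻ []       u = [] , u , λ ()
unique-++⁻ (x ∷ xs) u@(_ ∷ u′) with unique-++⁻ xs u′
... | uxs , uys , disj =
  unique-∷ (x∉ ∘ ∈-++⁺ˡ) uxs , uys ,
  λ { (here refl , x∈ys) → x∉ (∈-++⁺ʳ xs x∈ys) ; (there v∈xs , v∈ys) → disj (v∈xs , v∈ys) }
  where x∉ = Unique.Unique[x∷xs]⇒x∉xs u

unique-resp-↭ : {xs ys : List A} → xs ↭ ys → Unique xs → Unique ys
unique-resp-↭ p = PermutationSetoid.Unique-resp-↭ (setoid _) (↭⇒↭ₛ p)

_∈?_ : (x : Fin n) (xs : List (Fin n)) → Dec (x ∈ xs)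
x ∈? xs = DecMembership._∈?_ _≟_ x xs

EdgeSet : ℕ → Set
EdgeSet n = Fin n → Fin n → Bool

_⊕_ : EdgeSet n → EdgeSet n → EdgeSet n
(F ⊕ G) u v = F u v xor G u v

infixl 6 _⊕_

_≐_ : EdgeSet n → EdgeSet n → Set
F ≐ G = ∀ u v → F u v ≡ G u v

infix 4 _≐_

edge : Fin n → Fin n → EdgeSet n
edge x y u v = sameEdge u v x y

Undirected : EdgeSet n → Set
Undirected F = ∀ u v → F v u ≡ F u v

sameEdge-symʳ : (u v x y : Fin n) → sameEdge u v x y ≡ sameEdge u v y x
sameEdge-symʳ u v x y = ∨-comm (⌊ u ≟ x ⌋ ∧ ⌊ v ≟ y ⌋) (⌊ u ≟ y ⌋ ∧ ⌊ v ≟ x ⌋)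

edge-undirected : (x y : Fin n) → Undirected (edge x y)
edge-undirected x y u v =
  trans (cong₂ _∨_ (∧-comm ⌊ v ≟ x ⌋ ⌊ u ≟ y ⌋) (∧-comm ⌊ v ≟ y ⌋ ⌊ u ≟ x ⌋))
        (∨-comm (⌊ u ≟ y ⌋ ∧ ⌊ v ≟ x ⌋) (⌊ u ≟ x ⌋ ∧ ⌊ v ≟ y ⌋))

sameEdge⇒ : (u v x y : Fin n) → sameEdge u v x y ≡ true → (u ≡ x × v ≡ y) ⊎ (u ≡ y × v ≡ x)
sameEdge⇒ u v x y h with u ≟ x | v ≟ y | u ≟ y | v ≟ x
... | yes p | yes q | _     | _     = inj₁ (p , q)
... | _     | _     | yes p | yes q = inj₂ (p , q)
... | no _  | _     | no _  | _     = contradiction h λ ()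
... | no _  | _     | yes _ | no _  = contradiction h λ ()
... | yes _ | no _  | no _  | _     = contradiction h λ ()
... | yes _ | no _  | yes _ | no _  = contradiction h λ ()

sameEdge⇒endpoint : (u v x y : Fin n) → sameEdge u v x y ≡ true → u ≡ x ⊎ u ≡ y
sameEdge⇒endpoint u v x y = [ inj₁ ∘ proj₁ , inj₂ ∘ proj₁ ]′ ∘ sameEdge⇒ u v x y

sameEdge-refl : (x y : Fin n) → sameEdge x y x y ≡ true
sameEdge-refl x y =
  cong (_∨ (⌊ x ≟ y ⌋ ∧ ⌊ y ≟ x ⌋)) (cong₂ _∧_ (⌊⌋-true (x ≟ x) refl) (⌊⌋-true (y ≟ y) refl))

sameEdge-≢ : (u v x y : Fin n) → u ≢ x → u ≢ y → sameEdge u v x y ≡ false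
sameEdge-≢ u v x y u≢x u≢y =
  cong₂ (λ s t → (s ∧ ⌊ v ≟ y ⌋) ∨ (t ∧ ⌊ v ≟ x ⌋)) (⌊⌋-false (u ≟ x) u≢x) (⌊⌋-false (u ≟ y) u≢y)

sameEdge⇒≡ : (F : EdgeSet n) → Undirected F → (u v x y : Fin n) → sameEdge u v x y ≡ true → F u v ≡ F x y
sameEdge⇒≡ F F-undirected u v x y h with sameEdge⇒ u v x y h
... | inj₁ (refl , refl) = refl
... | inj₂ (refl , refl) = F-undirected _ _

-- Walks and the parity of their edge multisets

lastOf : A → List A → A
lastOf x []       = x
lastOf _ (y ∷ ys) = lastOf y ys

lastOf-++ : (x : A) (xs ys : List A) → lastOf x (xs ++ ys) ≡ lastOf (lastOf x xs) ys
lastOf-++ x []       ys = refl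
lastOf-++ x (y ∷ xs) ys = lastOf-++ y xs ys

lastOf-∷ʳ : (x : A) (xs : List A) (y : A) → lastOf x (xs ++ [ y ]) ≡ y
lastOf-∷ʳ x xs y = lastOf-++ x xs [ y ]

lastOf-∈ : (x : A) (xs : List A) → lastOf x xs ∈ x ∷ xs
lastOf-∈ x []       = here refl
lastOf-∈ x (y ∷ xs) = there (lastOf-∈ y xs)

walkParity : List (Fin n) → EdgeSet n
walkParity []           u v = false
walkParity (x ∷ [])     u v = false
walkParity (x ∷ y ∷ xs) u v = sameEdge u v x y xor walkParity (y ∷ xs) u v

walkParity-++ : (x : Fin n) (xs ys : List (Fin n)) →
                walkParity (x ∷ xs ++ ys) ≐ walkParity (x ∷ xs) ⊕ walkParity (lastOf x xs ∷ ys)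
walkParity-++ x []       ys u v = refl
walkParity-++ x (y ∷ xs) ys u v =
  trans (cong (sameEdge u v x y xor_) (walkParity-++ y xs ys u v)) (sym (xor-assoc (sameEdge u v x y) _ _))

walkParity-∷ʳ : (x : Fin n) (xs : List (Fin n)) (y : Fin n) →
                walkParity (x ∷ xs ++ [ y ]) ≐ walkParity (x ∷ xs) ⊕ edge (lastOf x xs) y
walkParity-∷ʳ x xs y u v =
  trans (walkParity-++ x xs [ y ] u v) (cong (walkParity (x ∷ xs) u v xor_) (xor-identityʳ _))

walkParity-undirected : (xs : List (Fin n)) → Undirected (walkParity xs)
walkParity-undirected []           u v = refl
walkParity-undirected (x ∷ [])     u v = refl
walkParity-undirected (x ∷ y ∷ xs) u v =
  cong₂ _xor_ (edge-undirected x y u v) (walkParity-undirected (y ∷ xs) u v)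

pathHasEdge-undirected : (xs : List (Fin n)) → Undirected (pathHasEdge xs)
pathHasEdge-undirected []           u v = refl
pathHasEdge-undirected (x ∷ [])     u v = refl
pathHasEdge-undirected (x ∷ y ∷ xs) u v =
  cong₂ _∨_ (edge-undirected x y u v) (pathHasEdge-undirected (y ∷ xs) u v)

pathHasEdge⇒∈ : (xs : List (Fin n)) (u v : Fin n) → pathHasEdge xs u v ≡ true → u ∈ xs × v ∈ xs
pathHasEdge⇒∈ (x ∷ ys@(y ∷ _)) u v h =
  [ endpoints ∘ sameEdge⇒ u v x y , map there there ∘ pathHasEdge⇒∈ ys u v ]′ (∨≡true⇒ _ _ h)
  where
  endpoints : (u ≡ x × v ≡ y) ⊎ (u ≡ y × v ≡ x) → u ∈ x ∷ ys × v ∈ x ∷ ys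
  endpoints (inj₁ (refl , refl)) = here refl , there (here refl)
  endpoints (inj₂ (refl , refl)) = there (here refl) , here refl

walkParity⇒pathHasEdge : (xs : List (Fin n)) (u v : Fin n) →
                         walkParity xs u v ≡ true → pathHasEdge xs u v ≡ true
walkParity⇒pathHasEdge (x ∷ ys@(y ∷ _)) u v h =
  [ cong (_∨ pathHasEdge ys u v)
  , (λ p → trans (cong (sameEdge u v x y ∨_) (walkParity⇒pathHasEdge ys u v p)) (∨-zeroʳ _))
  ]′ (xor≡true⇒ _ _ h)

walkParity⇒∈ : (xs : List (Fin n)) (u v : Fin n) → walkParity xs u v ≡ true → u ∈ xs × v ∈ xs
walkParity⇒∈ xs u v = pathHasEdge⇒∈ xs u v ∘ walkParity⇒pathHasEdge xs u v

walkParity-∉ : (xs : List (Fin n)) (u v : Fin n) → u ∉ xs → walkParity xs u v ≡ false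
walkParity-∉ xs u v u∉ = ¬-not (u∉ ∘ proj₁ ∘ walkParity⇒∈ xs u v)

pathHasEdge≡walkParity : (xs : List (Fin n)) → Unique xs → pathHasEdge xs ≐ walkParity xs
pathHasEdge≡walkParity []           _ u v = refl
pathHasEdge≡walkParity (x ∷ [])     _ u v = refl
pathHasEdge≡walkParity (x ∷ y ∷ xs) uniq@(_ ∷ uniq′) u v =
  trans (cong (sameEdge u v x y ∨_) (pathHasEdge≡walkParity (y ∷ xs) uniq′ u v))
        (∨≡xor _ _ exclusive)
  where
  x∉ = Unique.Unique[x∷xs]⇒x∉xs uniq
  exclusive : sameEdge u v x y ≡ true → walkParity (y ∷ xs) u v ≡ true → ⊥
  exclusive p q with sameEdge⇒ u v x y p
  ... | inj₁ (refl , _) = x∉ (proj₁ (walkParity⇒∈ (y ∷ xs) u v q))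
  ... | inj₂ (_ , refl) = x∉ (proj₂ (walkParity⇒∈ (y ∷ xs) u v q))

pathHasEdge-head : (x y : Fin n) (zs : List (Fin n)) (v : Fin n) → Unique (x ∷ y ∷ zs) →
                   pathHasEdge (x ∷ y ∷ zs) x v ≡ true → v ≡ y
pathHasEdge-head x y zs v uniq h with ∨≡true⇒ (sameEdge x v x y) _ h
... | inj₂ p = ⊥-elim (Unique.Unique[x∷xs]⇒x∉xs uniq (proj₁ (pathHasEdge⇒∈ (y ∷ zs) x v p)))
... | inj₁ p with sameEdge⇒ x v x y p
...   | inj₁ (_ , v≡y) = v≡y
...   | inj₂ (x≡y , _) = ⊥-elim (Unique.Unique[x∷xs]⇒x∉xs uniq (here x≡y))

pathHasEdge-∷ʳ : (x : Fin n) (xs : List (Fin n)) (y u v : Fin n) →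
                 pathHasEdge (x ∷ xs ++ [ y ]) u v ≡ pathHasEdge (x ∷ xs) u v ∨ sameEdge u v (lastOf x xs) y
pathHasEdge-∷ʳ x []       y u v = ∨-identityʳ _
pathHasEdge-∷ʳ x (z ∷ xs) y u v =
  trans (cong (sameEdge u v x z ∨_) (pathHasEdge-∷ʳ z xs y u v)) (sym (∨-assoc (sameEdge u v x z) _ _))

reverse-∷ : (x : A) (xs : List A) → ∃ λ ys → reverse (x ∷ xs) ≡ lastOf x xs ∷ ys × lastOf (lastOf x xs) ys ≡ x
reverse-∷ x []       = [] , refl , refl
reverse-∷ x (y ∷ xs) with reverse-∷ y xs
... | ys , rev≡ , last≡ =
  ys ++ [ x ] ,
  trans (unfold-reverse x (y ∷ xs)) (cong (_++ [ x ]) rev≡) ,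
  trans (lastOf-++ (lastOf y xs) ys [ x ]) (cong (λ z → lastOf z [ x ]) last≡)

walkParity-reverse : (x : Fin n) (xs : List (Fin n)) → walkParity (reverse (x ∷ xs)) ≐ walkParity (x ∷ xs)
walkParity-reverse x []       u v = refl
walkParity-reverse x (y ∷ xs) u v with reverse-∷ y xs
... | ys , rev≡ , last≡ =
  begin
    walkParity (reverse (x ∷ y ∷ xs)) u v
  ≡⟨ cong (λ zs → walkParity zs u v) (trans (unfold-reverse x (y ∷ xs)) (cong (_++ [ x ]) rev≡)) ⟩
    walkParity (ℓ ∷ ys ++ [ x ]) u v
  ≡⟨ walkParity-∷ʳ ℓ ys x u v ⟩
    walkParity (ℓ ∷ ys) u v xor sameEdge u v (lastOf ℓ ys) x
  ≡⟨ cong₂ (λ s t → s xor sameEdge u v t x)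
       (trans (cong (λ zs → walkParity zs u v) (sym rev≡)) (walkParity-reverse y xs u v)) last≡ ⟩
    walkParity (y ∷ xs) u v xor sameEdge u v y x
  ≡⟨ xor-comm (walkParity (y ∷ xs) u v) (sameEdge u v y x) ⟩
    sameEdge u v y x xor walkParity (y ∷ xs) u v
  ≡⟨ cong (_xor walkParity (y ∷ xs) u v) (sameEdge-symʳ u v y x) ⟩
    walkParity (x ∷ y ∷ xs) u v
  ∎
  where
  ℓ = lastOf y xs
  open ≡-Reasoning

closedWalkParity : List (Fin n) → EdgeSet n
closedWalkParity []       u v = false
closedWalkParity (x ∷ xs) u v = walkParity (x ∷ xs ++ [ x ]) u v

closedWalkParity-∷ : (x : Fin n) (xs : List (Fin n)) →
                     closedWalkParity (x ∷ xs) ≐ walkParity (x ∷ xs) ⊕ edge (lastOf x xs) x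
closedWalkParity-∷ x xs = walkParity-∷ʳ x xs x

closedWalkParity-rotate : (xs ys : List (Fin n)) → closedWalkParity (xs ++ ys) ≐ closedWalkParity (ys ++ xs)
closedWalkParity-rotate []       ys       u v = cong (λ zs → closedWalkParity zs u v) (sym (++-identityʳ ys))
closedWalkParity-rotate (x ∷ xs) []       u v = cong (λ zs → closedWalkParity zs u v) (++-identityʳ (x ∷ xs))
closedWalkParity-rotate (x ∷ xs) (y ∷ ys) u v =
  begin
    closedWalkParity (x ∷ xs ++ y ∷ ys) u v
  ≡⟨ closedWalkParity-∷ x (xs ++ y ∷ ys) u v ⟩
    walkParity (x ∷ xs ++ y ∷ ys) u v xor sameEdge u v (lastOf x (xs ++ y ∷ ys)) x
  ≡⟨ cong₂ (λ s t → s xor sameEdge u v t x) (walkParity-++ x xs (y ∷ ys) u v) (lastOf-++ x xs (y ∷ ys)) ⟩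
    (P xor (e₁ xor Q)) xor e₂
  ≡⟨ solve 4 (λ P e₁ Q e₂ → (P :+ (e₁ :+ Q)) :+ e₂ := (Q :+ (e₂ :+ P)) :+ e₁) refl P e₁ Q e₂ ⟩
    (Q xor (e₂ xor P)) xor e₁
  ≡⟨ sym (cong₂ (λ s t → s xor sameEdge u v t y) (walkParity-++ y ys (x ∷ xs) u v) (lastOf-++ y ys (x ∷ xs))) ⟩
    walkParity (y ∷ ys ++ x ∷ xs) u v xor sameEdge u v (lastOf y (ys ++ x ∷ xs)) y
  ≡⟨ sym (closedWalkParity-∷ y (ys ++ x ∷ xs) u v) ⟩
    closedWalkParity (y ∷ ys ++ x ∷ xs) u v
  ∎
  where
  open ≡-Reasoning
  P = walkParity (x ∷ xs) u v
  Q = walkParity (y ∷ ys) u v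
  e₁ = sameEdge u v (lastOf x xs) y
  e₂ = sameEdge u v (lastOf y ys) x

closedWalkParity⇒∈ : (C : List (Fin n)) (u v : Fin n) → closedWalkParity C u v ≡ true → u ∈ C
closedWalkParity⇒∈ (x ∷ xs) u v h with ∈-++⁻ (x ∷ xs) (proj₁ (walkParity⇒∈ (x ∷ xs ++ [ x ]) u v h))
... | inj₁ u∈C         = u∈C
... | inj₂ (here refl) = here refl

closedWalkParity-undirected : (C : List (Fin n)) → Undirected (closedWalkParity C)
closedWalkParity-undirected []       u v = refl
closedWalkParity-undirected (x ∷ xs) u v = walkParity-undirected (x ∷ xs ++ [ x ]) u v

cycleHasEdge≡closedWalkParity : (C : List (Fin n)) → IsCycle C → cycleHasEdge C ≐ closedWalkParity C
cycleHasEdge≡closedWalkParity []                (_ , ())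
cycleHasEdge≡closedWalkParity (_ ∷ [])          (_ , s≤s ())
cycleHasEdge≡closedWalkParity (_ ∷ _ ∷ [])      (_ , s≤s (s≤s ()))
cycleHasEdge≡closedWalkParity C@(x ∷ ys@(y ∷ zs@(z ∷ r))) (uniq@(_ ∷ uniqYs) , _) u v =
  begin
    pathHasEdge (x ∷ ys ++ [ x ]) u v
  ≡⟨ pathHasEdge-∷ʳ x ys x u v ⟩
    pathHasEdge C u v ∨ sameEdge u v ℓ x
  ≡⟨ cong (_∨ sameEdge u v ℓ x) (pathHasEdge≡walkParity C uniq u v) ⟩
    walkParity C u v ∨ sameEdge u v ℓ x
  ≡⟨ ∨≡xor _ _ exclusive ⟩
    walkParity C u v xor sameEdge u v ℓ x
  ≡⟨ sym (closedWalkParity-∷ x ys u v) ⟩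
    closedWalkParity C u v
  ∎
  where
  open ≡-Reasoning
  ℓ = lastOf z r
  -- The closing edge ℓx would be a second edge of the path C at its first vertex x.
  exclusive : walkParity C u v ≡ true → sameEdge u v ℓ x ≡ true → ⊥
  exclusive p q = Unique.Unique[x∷xs]⇒x∉xs uniqYs (subst (_∈ zs) ℓ≡y (lastOf-∈ z r))
    where
    x~ℓ : pathHasEdge C x ℓ ≡ true
    x~ℓ = begin
        pathHasEdge C x ℓ  ≡⟨ pathHasEdge-undirected C ℓ x ⟩
        pathHasEdge C ℓ x  ≡⟨ sameEdge⇒≡ (pathHasEdge C) (pathHasEdge-undirected C) u v ℓ x q ⟨
        pathHasEdge C u v  ≡⟨ walkParity⇒pathHasEdge C u v p ⟩
        true               ∎
    ℓ≡y : ℓ ≡ y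
    ℓ≡y = pathHasEdge-head x y zs ℓ uniq x~ℓ

cycleHasEdge-closing : (x : Fin n) (xs : List (Fin n)) → cycleHasEdge (x ∷ xs) (lastOf x xs) x ≡ true
cycleHasEdge-closing x xs =
  trans (pathHasEdge-∷ʳ x xs x ℓ x) (trans (cong (pathHasEdge (x ∷ xs) ℓ x ∨_) (sameEdge-refl ℓ x)) (∨-zeroʳ _))
  where ℓ = lastOf x xs

closedWalksParity : List (List (Fin n)) → EdgeSet n
closedWalksParity []       u v = false
closedWalksParity (C ∷ Cs) u v = closedWalkParity C u v xor closedWalksParity Cs u v

closedWalksParity⇒∈ : (Cs : List (List (Fin n))) (u v : Fin n) → closedWalksParity Cs u v ≡ true → u ∈ concat Cs
closedWalksParity⇒∈ (C ∷ Cs) u v h =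
  [ ∈-++⁺ˡ ∘ closedWalkParity⇒∈ C u v , ∈-++⁺ʳ C ∘ closedWalksParity⇒∈ Cs u v ]′ (xor≡true⇒ _ _ h)

closedWalksParity-∉ : (Cs : List (List (Fin n))) (u v : Fin n) → u ∉ concat Cs →
                      closedWalksParity Cs u v ≡ false
closedWalksParity-∉ Cs u v u∉ = ¬-not (u∉ ∘ closedWalksParity⇒∈ Cs u v)

closedWalksParity-undirected : (Cs : List (List (Fin n))) → Undirected (closedWalksParity Cs)
closedWalksParity-undirected []       u v = refl
closedWalksParity-undirected (C ∷ Cs) u v =
  cong₂ _xor_ (closedWalkParity-undirected C u v) (closedWalksParity-undirected Cs u v)

cyclesHaveEdge-undirected : (Cs : List (List (Fin n))) → Undirected (cyclesHaveEdge Cs)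
cyclesHaveEdge-undirected []              u v = refl
cyclesHaveEdge-undirected ([] ∷ Cs)       u v = cyclesHaveEdge-undirected Cs u v
cyclesHaveEdge-undirected ((x ∷ xs) ∷ Cs) u v =
  cong₂ _∨_ (pathHasEdge-undirected (x ∷ xs ++ [ x ]) u v) (cyclesHaveEdge-undirected Cs u v)

cyclesHaveEdge≡closedWalksParity : (Cs : List (List (Fin n))) → VertexDisjointCycles Cs →
                                   cyclesHaveEdge Cs ≐ closedWalksParity Cs
cyclesHaveEdge≡closedWalksParity []       _                   u v = refl
cyclesHaveEdge≡closedWalksParity (C ∷ Cs) (cyc ∷ cycs , uniq) u v =
  let _ , uniqCs , disjoint = unique-++⁻ C uniq in
  trans (cong₂ _∨_ (cycleHasEdge≡closedWalkParity C cyc u v)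
                   (cyclesHaveEdge≡closedWalksParity Cs (cycs , uniqCs) u v))
        (∨≡xor _ _ λ p q → disjoint (closedWalkParity⇒∈ C u v p , closedWalksParity⇒∈ Cs u v q))

-- Threading a family of cycles and shortcutting it

ends : List (List A) → List A
ends []            = []
ends ([] ∷ R)      = ends R
ends ((h ∷ m) ∷ R) = h ∷ lastOf h m ∷ ends R

lastOf-ends : (x : A) (R : List (List A)) → lastOf x (ends R) ≡ lastOf x (concat R)
lastOf-ends x []            = refl
lastOf-ends x ([] ∷ R)      = lastOf-ends x R
lastOf-ends x ((h ∷ m) ∷ R) = trans (lastOf-ends (lastOf h m) R) (sym (lastOf-++ h m (concat R)))

ends⊆concat : (R : List (List A)) {y : A} → y ∈ ends R → y ∈ concat R
ends⊆concat ([] ∷ R)      y∈                    = ends⊆concat R y∈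
ends⊆concat ((h ∷ m) ∷ R) (here refl)           = here refl
ends⊆concat ((h ∷ m) ∷ R) (there (here refl))   = ∈-++⁺ˡ (lastOf-∈ h m)
ends⊆concat ((h ∷ m) ∷ R) (there (there y∈))    = ∈-++⁺ʳ (h ∷ m) (ends⊆concat R y∈)

ends-unique : (R : List (List (Fin n))) → All IsCycle R → Unique (concat R) → Unique (ends R)
ends-unique []                    _                          _    = []
ends-unique ([] ∷ _)              ((_ , ()) ∷ _)             _
ends-unique ((_ ∷ []) ∷ _)        ((_ , s≤s ()) ∷ _)         _
ends-unique ((h ∷ m@(_ ∷ _)) ∷ R) ((uniqC , _) ∷ cycs) uniq =
  unique-∷ h∉ (unique-∷ ℓ∉ (ends-unique R cycs uniqR))
  where
  split = unique-++⁻ (h ∷ m) uniq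
  uniqR = proj₁ (proj₂ split)
  disjoint = proj₂ (proj₂ split)
  ℓ = lastOf h m
  h∉ : h ∉ ℓ ∷ ends R
  h∉ (here h≡ℓ)  = Unique.Unique[x∷xs]⇒x∉xs uniqC (subst (_∈ m) (sym h≡ℓ) (lastOf-∈ _ _))
  h∉ (there h∈) = disjoint (here refl , ends⊆concat R h∈)
  ℓ∉ : ℓ ∉ ends R
  ℓ∉ ℓ∈ = disjoint (lastOf-∈ h m , ends⊆concat R ℓ∈)

ends-∷ʳ-unique : (R : List (List (Fin n))) {y : Fin n} → All IsCycle R → Unique (concat R) → y ∉ concat R →
                 Unique (ends R ++ [ y ])
ends-∷ʳ-unique R cycs uniq y∉ =
  Unique.++⁺ (ends-unique R cycs uniq) ([] ∷ []) λ { (y∈ , here refl) → y∉ (ends⊆concat R y∈) }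

-- The connecting edges x h₁, ℓ₁ h₂, ℓ₂ h₃, … occur in both walks and cancel.
walkParity-concat⊕ends : (x : Fin n) (R : List (List (Fin n))) →
                         walkParity (x ∷ concat R) ⊕ walkParity (x ∷ ends R) ≐ closedWalksParity R
walkParity-concat⊕ends x []            u v = refl
walkParity-concat⊕ends x ([] ∷ R)      u v = walkParity-concat⊕ends x R u v
walkParity-concat⊕ends x ((h ∷ m) ∷ R) u v =
  begin
    (e₀ xor walkParity (h ∷ m ++ concat R) u v) xor (e₀ xor (e₁ xor walkParity (ℓ ∷ ends R) u v))
  ≡⟨ cong (λ s → (e₀ xor s) xor (e₀ xor (e₁ xor Y))) (walkParity-++ h m (concat R) u v) ⟩
    (e₀ xor (P xor X)) xor (e₀ xor (e₁ xor Y))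
  ≡⟨ solve 5 (λ e₀ P X e₁ Y → (e₀ :+ (P :+ X)) :+ (e₀ :+ (e₁ :+ Y)) := (P :+ e₁) :+ (X :+ Y)) refl e₀ P X e₁ Y ⟩
    (P xor e₁) xor (X xor Y)
  ≡⟨ cong₂ _xor_ (trans (cong (P xor_) (sameEdge-symʳ u v h ℓ)) (sym (closedWalkParity-∷ h m u v)))
                 (walkParity-concat⊕ends ℓ R u v) ⟩
    closedWalkParity (h ∷ m) u v xor closedWalksParity R u v
  ∎
  where
  open ≡-Reasoning
  ℓ = lastOf h m
  e₀ = sameEdge u v x h
  e₁ = sameEdge u v h ℓ
  P = walkParity (h ∷ m) u v
  X = walkParity (ℓ ∷ concat R) u v
  Y = walkParity (ℓ ∷ ends R) u v

walkParity-concat⊕ends-∷ : (x : Fin n) (R : List (List (Fin n))) (y : Fin n) (ys : List (Fin n)) →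
  walkParity (x ∷ concat R ++ y ∷ ys) ⊕ walkParity (x ∷ ends R ++ [ y ])
    ≐ closedWalksParity R ⊕ walkParity (y ∷ ys)
walkParity-concat⊕ends-∷ x R y ys u v =
  begin
    walkParity (x ∷ concat R ++ y ∷ ys) u v xor walkParity (x ∷ ends R ++ [ y ]) u v
  ≡⟨ cong₂ _xor_ (walkParity-++ x (concat R) (y ∷ ys) u v)
                 (trans (walkParity-∷ʳ x (ends R) y u v)
                        (cong (λ z → Y xor sameEdge u v z y) (lastOf-ends x R))) ⟩
    (X xor (e xor W)) xor (Y xor e)
  ≡⟨ solve 4 (λ X e W Y → (X :+ (e :+ W)) :+ (Y :+ e) := (X :+ Y) :+ W) refl X e W Y ⟩
    (X xor Y) xor W
  ≡⟨ cong (_xor W) (walkParity-concat⊕ends x R u v) ⟩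
    closedWalksParity R u v xor W
  ∎
  where
  open ≡-Reasoning
  X = walkParity (x ∷ concat R) u v
  Y = walkParity (x ∷ ends R) u v
  e = sameEdge u v (lastOf x (concat R)) y
  W = walkParity (y ∷ ys) u v

record SameCycle (C D : List (Fin n)) : Set where
  constructor sameCycle
  field
    vertices-↭ : C ↭ D
    parity-≐   : closedWalkParity C ≐ closedWalkParity D

record SameCycles (R S : List (List (Fin n))) : Set where
  constructor sameCycles
  field
    vertices-↭ : concat R ↭ concat S
    parity-≐   : closedWalksParity R ≐ closedWalksParity S

SameCycle-trans : {C D E : List (Fin n)} → SameCycle C D → SameCycle D E → SameCycle C E
SameCycle-trans (sameCycle p eq) (sameCycle p′ eq′) =
  sameCycle (↭-trans p p′) λ u v → trans (eq u v) (eq′ u v)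

SameCycles-trans : {R S T : List (List (Fin n))} → SameCycles R S → SameCycles S T → SameCycles R T
SameCycles-trans (sameCycles p eq) (sameCycles p′ eq′) =
  sameCycles (↭-trans p p′) λ u v → trans (eq u v) (eq′ u v)

SameCycles-∷ : {C C′ : List (Fin n)} {R R′ : List (List (Fin n))} →
               SameCycle C′ C → SameCycles R′ R → SameCycles (C′ ∷ R′) (C ∷ R)
SameCycles-∷ (sameCycle p eq) (sameCycles p′ eq′) = sameCycles (++⁺ p p′) λ u v → cong₂ _xor_ (eq u v) (eq′ u v)

SameCycles-↭ : {R S : List (List (Fin n))} → R ↭ S → SameCycles R S
SameCycles-↭ ↭.refl = sameCycles ↭-refl λ _ _ → refl
SameCycles-↭ (prep C p) with SameCycles-↭ p
... | sameCycles p′ eq = sameCycles (++⁺ˡ C p′) λ u v → cong (closedWalkParity C u v xor_) (eq u v)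
SameCycles-↭ (↭.swap C D p) with SameCycles-↭ p
... | sameCycles p′ eq =
  sameCycles (↭-trans (shifts C D) (++⁺ˡ D (++⁺ˡ C p′)))
    λ u v → trans (solve 3 (λ c d r → c :+ (d :+ r) := d :+ (c :+ r)) refl
                    (closedWalkParity C u v) (closedWalkParity D u v) _)
                  (cong (λ s → closedWalkParity D u v xor (closedWalkParity C u v xor s)) (eq u v))
SameCycles-↭ (↭.trans p p′) = SameCycles-trans (SameCycles-↭ p) (SameCycles-↭ p′)

rotate : (xs ys : List (Fin n)) → SameCycle (xs ++ ys) (ys ++ xs)
rotate xs ys = sameCycle (++-comm xs ys) (closedWalkParity-rotate xs ys)

IsCycle-resp-↭ : {C D : List (Fin n)} → C ↭ D → IsCycle D → IsCycle C
IsCycle-resp-↭ p (uniq , len) = unique-resp-↭ (↭-sym p) uniq , subst (3 ≤_) (sym (↭-length p)) len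

rotate-∈ : {c : Fin n} {C : List (Fin n)} → c ∈ C → ∃ λ K → SameCycle (c ∷ K) C
rotate-∈ {c = c} c∈ with ∈-∃++ c∈
... | L , M , refl = M ++ L , rotate (c ∷ M) L

rotateCycle-∈ : {x : Fin n} (C : List (Fin n)) → IsCycle C → x ∈ C →
                ∃₂ λ y z → ∃ λ r → IsCycle (x ∷ y ∷ z ∷ r) × SameCycle (x ∷ y ∷ z ∷ r) C
rotateCycle-∈ C cyc x∈ with rotate-∈ x∈
... | [] , sameCycle p _ with IsCycle-resp-↭ p cyc
...   | _ , s≤s ()
rotateCycle-∈ C cyc x∈ | _ ∷ [] , sameCycle p _ with IsCycle-resp-↭ p cyc
...   | _ , s≤s (s≤s ())
rotateCycle-∈ C cyc x∈ | y ∷ z ∷ r , same =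
  y , z , r , IsCycle-resp-↭ (SameCycle.vertices-↭ same) cyc , same

avoidEndsOfCycle : (x : Fin n) (C : List (Fin n)) → IsCycle C →
                   ∃₂ λ h m → IsCycle (h ∷ m) × SameCycle (h ∷ m) C × x ≢ h × x ≢ lastOf h m
avoidEndsOfCycle x []         (_ , ())
avoidEndsOfCycle x C@(h ∷ m) cyc with x ∈? C
... | no x∉C =
  h , m , cyc , sameCycle ↭-refl (λ _ _ → refl) , x∉C ∘ here ,
  λ x≡ℓ → x∉C (subst (_∈ C) (sym x≡ℓ) (lastOf-∈ h m))
... | yes x∈C with rotateCycle-∈ C cyc x∈C
...   | y , z , r , cyc′ , same =
  z , r ++ x ∷ y ∷ [] , IsCycle-resp-↭ (SameCycle.vertices-↭ same′) cyc , same′ ,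
  (λ x≡z → x∉ (there (here x≡z))) , (λ x≡ℓ → x∉ (here (trans x≡ℓ (lastOf-++ z r (x ∷ y ∷ [])))))
  where
  same′ = SameCycle-trans (rotate (z ∷ r) (x ∷ y ∷ [])) same
  x∉ = Unique.Unique[x∷xs]⇒x∉xs (proj₁ cyc′)

avoidEnds : (x : Fin n) (R : List (List (Fin n))) → All IsCycle R →
            ∃ λ R′ → All IsCycle R′ × SameCycles R′ R × x ∉ ends R′
avoidEnds x []       []           = [] , [] , sameCycles ↭-refl (λ _ _ → refl) , λ ()
avoidEnds x (C ∷ R) (cyc ∷ cycs) with avoidEndsOfCycle x C cyc | avoidEnds x R cycs
... | h , m , cyc′ , same , x≢h , x≢ℓ | R′ , cycs′ , same′ , x∉ =
  (h ∷ m) ∷ R′ , cyc′ ∷ cycs′ , SameCycles-∷ same same′ ,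
  λ { (here x≡h) → x≢h x≡h ; (there (here x≡ℓ)) → x≢ℓ x≡ℓ ; (there (there x∈)) → x∉ x∈ }

rotateToFront : {c : Fin n} (d : Fin n) (R : List (List (Fin n))) → All IsCycle R → c ∈ concat R →
                ∃₂ λ m R₁ → All IsCycle ((c ∷ m) ∷ R₁) × SameCycles ((c ∷ m) ∷ R₁) R × d ∉ ends R₁
rotateToFront d R cycs c∈ with ∈-concat⁻′ R c∈
... | C , c∈C , C∈R with ∈-∃++ C∈R
...   | Pre , Post , refl with All.++⁻ Pre cycs
...     | cycsPre , cycC ∷ cycsPost
        with rotateCycle-∈ C cycC c∈C | avoidEnds d (Pre ++ Post) (All.++⁺ cycsPre cycsPost)
...       | y , z , r , cyc′ , same | R₁ , cycs₁ , same₁ , d∉ =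
  y ∷ z ∷ r , R₁ , cyc′ ∷ cycs₁ ,
  SameCycles-trans (SameCycles-∷ same same₁) (SameCycles-↭ (↭-sym (shift C Pre Post))) , d∉

-- Two paths covering a path, a family of cycles and an edge

TwoPathCover : EdgeSet n → Set
TwoPathCover {n} F = ∃₂ λ (P₁ P₂ : List (Fin n)) → IsPath P₁ × IsPath P₂ × walkParity P₁ ⊕ walkParity P₂ ≐ F

TwoPathCover-resp : {F G : EdgeSet n} → F ≐ G → TwoPathCover F → TwoPathCover G
TwoPathCover-resp F≐G (P₁ , P₂ , path₁ , path₂ , eq) =
  P₁ , P₂ , path₁ , path₂ , λ u v → trans (eq u v) (F≐G u v)

leadingEdge-≐ : (Q : List (Fin n)) (R : List (List (Fin n))) (c d : Fin n) →
  edge d c ⊕ (closedWalksParity R ⊕ walkParity Q) ≐ walkParity Q ⊕ closedWalksParity R ⊕ edge c d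
leadingEdge-≐ Q R c d u v =
  trans (solve 3 (λ e r w → e :+ (r :+ w) := (w :+ r) :+ e) refl
                 (sameEdge u v d c) (closedWalksParity R u v) (walkParity Q u v))
        (cong ((walkParity Q u v xor closedWalksParity R u v) xor_) (sameEdge-symʳ u v d c))

twoPathCover-leadingVertex :
  (b : Fin n) (q : List (Fin n)) (c : Fin n) (m : List (Fin n)) (R₁ : List (List (Fin n))) (d : Fin n) →
  let R = (c ∷ m) ∷ R₁ in
  Unique (b ∷ q ++ concat R) → All IsCycle R → c ≢ d → b ≢ d → d ∉ ends R₁ →
  (walkParity (b ∷ q) ⊕ closedWalksParity R) c d ≡ false →
  TwoPathCover (walkParity (b ∷ q) ⊕ closedWalksParity R ⊕ edge c d)
twoPathCover-leadingVertex b q c m R₁ d uniq cycs@(cyc ∷ _) c≢d b≢d d∉ends₁ cd∉ =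
  P₁ , P₂ , (uniq₁ , s≤s z≤n) , (uniq₂ , s≤s z≤n) , parity
  where
  R = (c ∷ m) ∷ R₁
  ℓ = lastOf c m
  P₁ = concat R ++ b ∷ q
  P₂ = d ∷ ends R ++ [ b ]
  Q = b ∷ q
  uniqR = proj₁ (proj₂ (unique-++⁻ Q uniq))
  disjoint = proj₂ (proj₂ (unique-++⁻ Q uniq))
  c∉Q : c ∉ Q
  c∉Q c∈ = disjoint (c∈ , here refl)
  c∉R₁ : c ∉ concat R₁
  c∉R₁ = Unique.Unique[x∷xs]⇒x∉xs uniqR ∘ ∈-++⁺ʳ m
  closing : closedWalkParity (c ∷ m) c ℓ ≡ true
  closing = trans (closedWalkParity-undirected (c ∷ m) ℓ c)
                  (trans (sym (cycleHasEdge≡closedWalkParity (c ∷ m) cyc ℓ c)) (cycleHasEdge-closing c m))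
  cℓ∈ : (walkParity Q ⊕ closedWalksParity R) c ℓ ≡ true
  cℓ∈ = trans (cong₂ (λ s t → s xor (closedWalkParity (c ∷ m) c ℓ xor t))
                     (walkParity-∉ Q c ℓ c∉Q) (closedWalksParity-∉ R₁ c ℓ c∉R₁))
              (cong (_xor false) closing)
  -- ℓ c closes the first cycle, so d = ℓ would put cd into the edge set.
  d≢ℓ : d ≢ ℓ
  d≢ℓ d≡ℓ = contradiction
    (trans (sym cd∉) (subst (λ y → (walkParity Q ⊕ closedWalksParity R) c y ≡ true) (sym d≡ℓ) cℓ∈)) λ ()
  uniq₁ : Unique P₁
  uniq₁ = unique-resp-↭ (++-comm Q (concat R)) uniq
  d∉ : d ∉ ends R ++ [ b ]
  d∉ (here d≡c)          = c≢d (sym d≡c)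
  d∉ (there (here d≡ℓ))  = d≢ℓ d≡ℓ
  d∉ (there (there d∈)) with ∈-++⁻ (ends R₁) d∈
  ... | inj₁ d∈ends₁    = d∉ends₁ d∈ends₁
  ... | inj₂ (here d≡b) = b≢d (sym d≡b)
  uniq₂ : Unique P₂
  uniq₂ = unique-∷ d∉ (ends-∷ʳ-unique R cycs uniqR λ b∈ → disjoint (here refl , b∈))
  parity : walkParity P₁ ⊕ walkParity P₂ ≐ walkParity Q ⊕ closedWalksParity R ⊕ edge c d
  parity u v =
    begin
      walkParity P₁ u v xor walkParity P₂ u v
    ≡⟨ solve 3 (λ e p w → p :+ w := e :+ ((e :+ p) :+ w)) refl e (walkParity P₁ u v) (walkParity P₂ u v) ⟩
      e xor (walkParity (d ∷ P₁) u v xor walkParity P₂ u v)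
    ≡⟨ cong (e xor_) (walkParity-concat⊕ends-∷ d R b q u v) ⟩
      e xor (closedWalksParity R u v xor walkParity Q u v)
    ≡⟨ leadingEdge-≐ Q R c d u v ⟩
      (walkParity Q u v xor closedWalksParity R u v) xor sameEdge u v c d
    ∎
    where
    open ≡-Reasoning
    e = sameEdge u v d c

twoPathCover-newVertex : (b : Fin n) (q : List (Fin n)) (R : List (List (Fin n))) (c d : Fin n) →
  Unique (b ∷ q ++ concat R) → All IsCycle R → c ∉ b ∷ q ++ concat R → d ∉ concat R → c ≢ d → b ≢ d →
  TwoPathCover (walkParity (b ∷ q) ⊕ closedWalksParity R ⊕ edge c d)
twoPathCover-newVertex b q R c d uniq cycs c∉ d∉R c≢d b≢d =
  P₁ , P₂ , (uniq₁ , s≤s z≤n) , (uniq₂ , s≤s z≤n) , parity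
  where
  Q = b ∷ q
  P₁ = c ∷ concat R ++ Q
  P₂ = d ∷ c ∷ ends R ++ [ b ]
  R↭ = ++-comm Q (concat R)
  uniqR = proj₁ (proj₂ (unique-++⁻ Q uniq))
  c∉R = c∉ ∘ ∈-++⁺ʳ Q
  uniq₁ : Unique P₁
  uniq₁ = unique-∷ (c∉ ∘ ∈-resp-↭ (↭-sym R↭)) (unique-resp-↭ R↭ uniq)
  c∉ends : c ∉ ends R ++ [ b ]
  c∉ends c∈ with ∈-++⁻ (ends R) c∈
  ... | inj₁ c∈ends     = c∉R (ends⊆concat R c∈ends)
  ... | inj₂ (here c≡b) = c∉ (here c≡b)
  d∉ends : d ∉ c ∷ ends R ++ [ b ]
  d∉ends (here d≡c) = c≢d (sym d≡c)
  d∉ends (there d∈) with ∈-++⁻ (ends R) d∈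
  ... | inj₁ d∈ends     = d∉R (ends⊆concat R d∈ends)
  ... | inj₂ (here d≡b) = b≢d (sym d≡b)
  uniq₂ : Unique P₂
  uniq₂ = unique-∷ d∉ends (unique-∷ c∉ends (ends-∷ʳ-unique R cycs uniqR
            λ b∈ → proj₂ (proj₂ (unique-++⁻ Q uniq)) (here refl , b∈)))
  parity : walkParity P₁ ⊕ walkParity P₂ ≐ walkParity Q ⊕ closedWalksParity R ⊕ edge c d
  parity u v =
    begin
      walkParity P₁ u v xor (e xor walkParity (c ∷ ends R ++ [ b ]) u v)
    ≡⟨ solve 3 (λ p e w → p :+ (e :+ w) := e :+ (p :+ w)) refl (walkParity P₁ u v) e _ ⟩
      e xor (walkParity P₁ u v xor walkParity (c ∷ ends R ++ [ b ]) u v)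
    ≡⟨ cong (e xor_) (walkParity-concat⊕ends-∷ c R b q u v) ⟩
      e xor (closedWalksParity R u v xor walkParity Q u v)
    ≡⟨ leadingEdge-≐ Q R c d u v ⟩
      (walkParity Q u v xor closedWalksParity R u v) xor sameEdge u v c d
    ∎
    where
    open ≡-Reasoning
    e = sameEdge u v d c

twoPathCover-pathVertex : (b : Fin n) (q : List (Fin n)) (R : List (List (Fin n))) (c d : Fin n) →
  Unique (b ∷ q ++ concat R) → All IsCycle R → d ∈ q → c ∉ concat R → c ≢ d →
  lastOf b q ≢ c → lastOf b q ≢ d →
  (walkParity (b ∷ q) ⊕ closedWalksParity R) c d ≡ false →
  TwoPathCover (walkParity (b ∷ q) ⊕ closedWalksParity R ⊕ edge c d)
twoPathCover-pathVertex b q R c d uniq cycs d∈q c∉R c≢d a≢c a≢d cd∉ with ∈-∃++ d∈q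
... | q₁ , Q₂ , refl with reverse-∷ d Q₂
...   | q′ , rev≡ , _ =
  P₁ , P₂ , (uniq₁ , s≤s z≤n) , (uniq₂ , s≤s z≤n) , parity
  where
  Q₁ = b ∷ q₁
  Q = Q₁ ++ d ∷ Q₂
  p = lastOf b q₁
  a = lastOf d Q₂
  a≡ : lastOf b q ≡ a
  a≡ = lastOf-++ b q₁ (d ∷ Q₂)
  P₁ = Q₁ ++ concat R ++ reverse (d ∷ Q₂)
  P₂ = c ∷ d ∷ p ∷ ends R ++ [ a ]
  uniqQ = proj₁ (unique-++⁻ Q uniq)
  uniqR = proj₁ (proj₂ (unique-++⁻ Q uniq))
  ∉R : ∀ {x} → x ∈ Q → x ∉ concat R
  ∉R x∈Q x∈R = proj₂ (proj₂ (unique-++⁻ Q uniq)) (x∈Q , x∈R)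
  Q₁#Q₂ = proj₂ (proj₂ (unique-++⁻ Q₁ uniqQ))
  p∈Q₁ = lastOf-∈ b q₁
  a∈Q₂ = lastOf-∈ d Q₂
  P₁↭ : P₁ ↭ Q ++ concat R
  P₁↭ = ↭-trans (++⁺ˡ Q₁ (↭-trans (++-comm (concat R) (reverse (d ∷ Q₂)))
                                  (++⁺ʳ (concat R) (↭-reverse (d ∷ Q₂)))))
                (↭-reflexive (sym (++-assoc Q₁ (d ∷ Q₂) (concat R))))
  uniq₁ : Unique P₁
  uniq₁ = unique-resp-↭ (↭-sym P₁↭) uniq
  pd∈ : walkParity Q p d ≡ true
  pd∈ = begin
      walkParity Q p d
    ≡⟨ walkParity-++ b q₁ (d ∷ Q₂) p d ⟩
      walkParity Q₁ p d xor (sameEdge p d p d xor walkParity (d ∷ Q₂) p d)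
    ≡⟨ cong₂ (λ s t → s xor (sameEdge p d p d xor t))
             (trans (walkParity-undirected Q₁ d p) (walkParity-∉ Q₁ d p λ d∈ → Q₁#Q₂ (d∈ , here refl)))
             (walkParity-∉ (d ∷ Q₂) p d λ p∈ → Q₁#Q₂ (p∈Q₁ , p∈)) ⟩
      false xor (sameEdge p d p d xor false)
    ≡⟨ cong (λ s → s xor false) (sameEdge-refl p d) ⟩
      true
    ∎
    where open ≡-Reasoning
  -- p d is the edge of Q at d, so c = p would put cd into the edge set.
  c≢p : c ≢ p
  c≢p c≡p = contradiction
    (trans (sym cd∉) (cong₂ _xor_ (trans (cong (λ x → walkParity Q x d) c≡p) pd∈)
                                  (closedWalksParity-∉ R c d c∉R)))
    λ ()
  p∉ : p ∉ ends R ++ [ a ]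
  p∉ p∈ with ∈-++⁻ (ends R) p∈
  ... | inj₁ p∈ends     = ∉R (∈-++⁺ˡ p∈Q₁) (ends⊆concat R p∈ends)
  ... | inj₂ (here p≡a) = Q₁#Q₂ (p∈Q₁ , subst (_∈ d ∷ Q₂) (sym p≡a) a∈Q₂)
  d∉ : d ∉ p ∷ ends R ++ [ a ]
  d∉ (here d≡p)  = Q₁#Q₂ (subst (_∈ Q₁) (sym d≡p) p∈Q₁ , here refl)
  d∉ (there d∈) with ∈-++⁻ (ends R) d∈
  ... | inj₁ d∈ends     = ∉R (∈-++⁺ʳ Q₁ (here refl)) (ends⊆concat R d∈ends)
  ... | inj₂ (here d≡a) = a≢d (trans a≡ (sym d≡a))
  c∉ : c ∉ d ∷ p ∷ ends R ++ [ a ]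
  c∉ (here c≡d)         = c≢d c≡d
  c∉ (there (here c≡p)) = c≢p c≡p
  c∉ (there (there c∈)) with ∈-++⁻ (ends R) c∈
  ... | inj₁ c∈ends     = c∉R (ends⊆concat R c∈ends)
  ... | inj₂ (here c≡a) = a≢c (trans a≡ (sym c≡a))
  uniq₂ : Unique P₂
  uniq₂ = unique-∷ c∉ (unique-∷ d∉ (unique-∷ p∉ (ends-∷ʳ-unique R cycs uniqR (∉R (∈-++⁺ʳ Q₁ a∈Q₂)))))
  parity : walkParity P₁ ⊕ walkParity P₂ ≐ walkParity Q ⊕ closedWalksParity R ⊕ edge c d
  parity u v =
    begin
      walkParity P₁ u v xor (e xor (e′ xor walkParity (p ∷ ends R ++ [ a ]) u v))
    ≡⟨ cong (_xor (e xor (e′ xor Y))) (trans (walkParity-++ b q₁ (concat R ++ reverse (d ∷ Q₂)) u v)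
                                            (cong (λ zs → W₁ xor walkParity (p ∷ concat R ++ zs) u v) rev≡)) ⟩
      (W₁ xor X) xor (e xor (e′ xor Y))
    ≡⟨ solve 5 (λ W₁ X e e′ Y → (W₁ :+ X) :+ (e :+ (e′ :+ Y)) := ((W₁ :+ e′) :+ (X :+ Y)) :+ e)
               refl W₁ X e e′ Y ⟩
      ((W₁ xor e′) xor (X xor Y)) xor e
    ≡⟨ cong (λ s → ((W₁ xor e′) xor s) xor e) (walkParity-concat⊕ends-∷ p R a q′ u v) ⟩
      ((W₁ xor e′) xor (closedWalksParity R u v xor walkParity (a ∷ q′) u v)) xor e
    ≡⟨ cong (λ s → ((W₁ xor e′) xor (closedWalksParity R u v xor s)) xor e)
            (trans (cong (λ zs → walkParity zs u v) (sym rev≡)) (walkParity-reverse d Q₂ u v)) ⟩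
      ((W₁ xor e′) xor (closedWalksParity R u v xor W₂)) xor e
    ≡⟨ cong (_xor e) (solve 4 (λ W₁ e′ Σ W₂ → (W₁ :+ e′) :+ (Σ :+ W₂) := (W₁ :+ (e′ :+ W₂)) :+ Σ)
                             refl W₁ e′ (closedWalksParity R u v) W₂) ⟩
      ((W₁ xor (e′ xor W₂)) xor closedWalksParity R u v) xor e
    ≡⟨ cong (λ s → ((W₁ xor (s xor W₂)) xor closedWalksParity R u v) xor e) (sameEdge-symʳ u v d p) ⟩
      ((W₁ xor (sameEdge u v p d xor W₂)) xor closedWalksParity R u v) xor e
    ≡⟨ cong (λ s → (s xor closedWalksParity R u v) xor e) (sym (walkParity-++ b q₁ (d ∷ Q₂) u v)) ⟩
      (walkParity Q u v xor closedWalksParity R u v) xor e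
    ∎
    where
    open ≡-Reasoning
    e = sameEdge u v c d
    e′ = sameEdge u v d p
    W₁ = walkParity Q₁ u v
    W₂ = walkParity (d ∷ Q₂) u v
    X = walkParity (p ∷ concat R ++ a ∷ q′) u v
    Y = walkParity (p ∷ ends R ++ [ a ]) u v

twoPathCover-cycleVertex : (b : Fin n) (q : List (Fin n)) (R : List (List (Fin n))) (c d : Fin n) →
  Unique (b ∷ q ++ concat R) → All IsCycle R → c ∈ concat R → c ≢ d → b ≢ d →
  (walkParity (b ∷ q) ⊕ closedWalksParity R) c d ≡ false →
  TwoPathCover (walkParity (b ∷ q) ⊕ closedWalksParity R ⊕ edge c d)
twoPathCover-cycleVertex b q R c d uniq cycs c∈R c≢d b≢d cd∉ with rotateToFront d R cycs c∈R
... | m , R₁ , cycs′ , sameCycles R′↭R R′≐R , d∉ends =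
  TwoPathCover-resp (λ u v → cong (λ s → (walkParity (b ∷ q) u v xor s) xor sameEdge u v c d) (R′≐R u v))
    (twoPathCover-leadingVertex b q c m R₁ d (unique-resp-↭ (prep b (++⁺ˡ q (↭-sym R′↭R))) uniq) cycs′ c≢d b≢d
      d∉ends (trans (cong (walkParity (b ∷ q) c d xor_) (R′≐R c d)) cd∉))

twoPathCover-flip : (F : EdgeSet n) (c d : Fin n) → TwoPathCover (F ⊕ edge d c) → TwoPathCover (F ⊕ edge c d)
twoPathCover-flip F c d = TwoPathCover-resp λ u v → cong (F u v xor_) (sameEdge-symʳ u v d c)

twoPathCover : (b : Fin n) (q : List (Fin n)) (R : List (List (Fin n))) (c d : Fin n) →
  Unique (b ∷ q ++ concat R) → All IsCycle R →
  c ≢ d → b ≢ c → b ≢ d → lastOf b q ≢ c → lastOf b q ≢ d →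
  (walkParity (b ∷ q) ⊕ closedWalksParity R) c d ≡ false →
  TwoPathCover (walkParity (b ∷ q) ⊕ closedWalksParity R ⊕ edge c d)
twoPathCover b q R c d uniq cycs c≢d b≢c b≢d a≢c a≢d cd∉ with c ∈? concat R | d ∈? concat R | d ∈? q
... | yes c∈R | _       | _       = twoPathCover-cycleVertex b q R c d uniq cycs c∈R c≢d b≢d cd∉
... | no _    | yes d∈R | _       =
  twoPathCover-flip F c d (twoPathCover-cycleVertex b q R d c uniq cycs d∈R (c≢d ∘ sym) b≢c
    (trans (cong₂ _xor_ (walkParity-undirected (b ∷ q) c d) (closedWalksParity-undirected R c d)) cd∉))
  where F = walkParity (b ∷ q) ⊕ closedWalksParity R
... | no c∉R  | no _    | yes d∈q = twoPathCover-pathVertex b q R c d uniq cycs d∈q c∉R c≢d a≢c a≢d cd∉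
... | no c∉R  | no d∉R  | no d∉q  =
  twoPathCover-flip F c d (twoPathCover-newVertex b q R d c uniq cycs d∉ c∉R (c≢d ∘ sym) b≢c)
  where
  F = walkParity (b ∷ q) ⊕ closedWalksParity R
  d∉ : d ∉ b ∷ q ++ concat R
  d∉ (here d≡b) = b≢d (sym d≡b)
  d∉ (there d∈) = [ d∉q , d∉R ]′ (∈-++⁻ q d∈)

-- Opening the cycle through ab

cyclesHaveEdge⇒∈ : (Cs : List (List (Fin n))) (a b : Fin n) → cyclesHaveEdge Cs a b ≡ true →
                   ∃ λ C → C ∈ Cs × cycleHasEdge C a b ≡ true
cyclesHaveEdge⇒∈ (C ∷ Cs) a b h = [ (λ p → C , here refl , p) , there-case ]′ (∨≡true⇒ _ _ h)
  where
  there-case : cyclesHaveEdge Cs a b ≡ true → ∃ λ D → D ∈ C ∷ Cs × cycleHasEdge D a b ≡ true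
  there-case p = let D , D∈ , q = cyclesHaveEdge⇒∈ Cs a b p in D , there D∈ , q

pathHasEdge⇒split : (xs : List (Fin n)) (a b : Fin n) → pathHasEdge xs a b ≡ true →
                    ∃₂ λ ys zs → ∃₂ λ y z → xs ≡ ys ++ y ∷ z ∷ zs × sameEdge a b y z ≡ true
pathHasEdge⇒split (x ∷ ws@(y ∷ zs)) a b h =
  [ (λ p → [] , zs , x , y , refl , p)
  , (λ p → let ys , zs′ , y′ , z′ , eq , e = pathHasEdge⇒split ws a b p
           in x ∷ ys , zs′ , y′ , z′ , cong (x ∷_) eq , e)
  ]′ (∨≡true⇒ _ _ h)

rotateToClosingEdge : (C : List (Fin n)) (a b : Fin n) → cycleHasEdge C a b ≡ true →
                      ∃₂ λ s m → SameCycle (s ∷ m) C × sameEdge a b (lastOf s m) s ≡ true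
rotateToClosingEdge (x ∷ xs) a b h with ∨≡true⇒ _ _ (trans (sym (pathHasEdge-∷ʳ x xs x a b)) h)
... | inj₂ closing = x , xs , sameCycle ↭-refl (λ _ _ → refl) , closing
... | inj₁ inner with pathHasEdge⇒split (x ∷ xs) a b inner
...   | ys , zs , y , z , x∷xs≡ , yz =
  z , zs ++ ys ++ [ y ] ,
  subst (SameCycle (z ∷ zs ++ ys ++ [ y ])) (trans (++-assoc ys [ y ] (z ∷ zs)) (sym x∷xs≡))
        (rotate (z ∷ zs) (ys ++ [ y ])) ,
  subst (λ w → sameEdge a b w z ≡ true) (sym (trans (lastOf-++ z zs (ys ++ [ y ])) (lastOf-∷ʳ _ ys y))) yz

openCycle : (C : List (Fin n)) (a b : Fin n) → cycleHasEdge C a b ≡ true →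
            ∃ λ q → b ∷ q ↭ C × lastOf b q ≡ a × closedWalkParity C ≐ walkParity (b ∷ q) ⊕ edge a b
openCycle C a b h with rotateToClosingEdge C a b h
... | s , m , sameCycle p eq , closing with sameEdge⇒ a b (lastOf s m) s closing
...   | inj₁ (refl , refl) = m , p , refl , λ u v → trans (sym (eq u v)) (closedWalkParity-∷ s m u v)
...   | inj₂ (refl , refl) with reverse-∷ s m
...     | q , rev≡ , last≡ =
  q , ↭-trans (subst (_↭ s ∷ m) rev≡ (↭-reverse (s ∷ m))) p , last≡ ,
  λ u v → trans (sym (eq u v)) (trans (closedWalkParity-∷ s m u v)
    (cong₂ _xor_ (trans (sym (walkParity-reverse s m u v)) (cong (λ zs → walkParity zs u v) rev≡))
                 (sameEdge-symʳ u v (lastOf s m) s)))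

openCyclesAt : (Cs : List (List (Fin n))) (a b : Fin n) →
  VertexDisjointCycles Cs → cyclesHaveEdge Cs a b ≡ true →
  ∃₂ λ q R → lastOf b q ≡ a × Unique (b ∷ q ++ concat R) × All IsCycle R ×
             cyclesHaveEdge Cs ≐ walkParity (b ∷ q) ⊕ closedWalksParity R ⊕ edge a b
openCyclesAt Cs a b disjointCycles@(cycs , uniq) ab∈ with cyclesHaveEdge⇒∈ Cs a b ab∈
... | C , C∈Cs , ab∈C with ∈-∃++ C∈Cs
...   | Pre , Post , refl with All.++⁻ Pre cycs | openCycle C a b ab∈C
...     | cycsPre , _ ∷ cycsPost | q , bq↭C , a≡ , C≐ =
  q , Pre ++ Post , a≡ , unique-resp-↭ (↭-trans Cs↭ (++⁺ʳ (concat (Pre ++ Post)) (↭-sym bq↭C))) uniq ,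
  All.++⁺ cycsPre cycsPost , Cs≐
  where
  open SameCycles (SameCycles-↭ (shift C Pre Post)) renaming (vertices-↭ to Cs↭; parity-≐ to Cs-parity)
  Cs≐ : cyclesHaveEdge (Pre ++ C ∷ Post) ≐ walkParity (b ∷ q) ⊕ closedWalksParity (Pre ++ Post) ⊕ edge a b
  Cs≐ u v =
    begin
      cyclesHaveEdge (Pre ++ C ∷ Post) u v
    ≡⟨ cyclesHaveEdge≡closedWalksParity (Pre ++ C ∷ Post) disjointCycles u v ⟩
      closedWalksParity (Pre ++ C ∷ Post) u v
    ≡⟨ Cs-parity u v ⟩
      closedWalkParity C u v xor closedWalksParity (Pre ++ Post) u v
    ≡⟨ cong (_xor closedWalksParity (Pre ++ Post) u v) (C≐ u v) ⟩
      (walkParity (b ∷ q) u v xor sameEdge u v a b) xor closedWalksParity (Pre ++ Post) u v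
    ≡⟨ solve 3 (λ w e r → (w :+ e) :+ r := (w :+ r) :+ e) refl
         (walkParity (b ∷ q) u v) (sameEdge u v a b) (closedWalksParity (Pre ++ Post) u v) ⟩
      (walkParity (b ∷ q) u v xor closedWalksParity (Pre ++ Post) u v) xor sameEdge u v a b
    ∎
    where open ≡-Reasoning

swapEdges-≐ : (Cs : List (List (Fin n))) (a b c d : Fin n) →
  cyclesHaveEdge Cs a b ≡ true → cyclesHaveEdge Cs c d ≡ false → a ≢ c → a ≢ d → b ≢ c → b ≢ d →
  swapEdges Cs a b c d ≐ cyclesHaveEdge Cs ⊕ edge a b ⊕ edge c d
swapEdges-≐ Cs a b c d ab∈ cd∉ a≢c a≢d b≢c b≢d u v with sameEdge u v a b in uv≡ab | sameEdge u v c d in uv≡cd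
... | true  | true
    with sameEdge⇒endpoint u v a b uv≡ab | sameEdge⇒endpoint u v c d uv≡cd
...   | inj₁ u≡a | inj₁ u≡c = ⊥-elim (a≢c (trans (sym u≡a) u≡c))
...   | inj₁ u≡a | inj₂ u≡d = ⊥-elim (a≢d (trans (sym u≡a) u≡d))
...   | inj₂ u≡b | inj₁ u≡c = ⊥-elim (b≢c (trans (sym u≡b) u≡c))
...   | inj₂ u≡b | inj₂ u≡d = ⊥-elim (b≢d (trans (sym u≡b) u≡d))
swapEdges-≐ Cs a b c d ab∈ cd∉ _ _ _ _ u v | true | false
  rewrite trans (sameEdge⇒≡ (cyclesHaveEdge Cs) (cyclesHaveEdge-undirected Cs) u v a b uv≡ab) ab∈ = refl
swapEdges-≐ Cs a b c d ab∈ cd∉ _ _ _ _ u v | false | true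
  rewrite trans (sameEdge⇒≡ (cyclesHaveEdge Cs) (cyclesHaveEdge-undirected Cs) u v c d uv≡cd) cd∉ = refl
swapEdges-≐ Cs a b c d ab∈ cd∉ _ _ _ _ u v | false | false =
  sym (trans (xor-identityʳ _) (xor-identityʳ _))

lemma3p9 : (n : ℕ) (Cs : List (List (Fin n))) → VertexDisjointCycles Cs →
    (a b c d : Fin n) → a ≢ b → c ≢ d →
    cyclesHaveEdge Cs a b ≡ true → cyclesHaveEdge Cs c d ≡ false →
    a ≢ c → a ≢ d → b ≢ c → b ≢ d →
    ∃₂ λ (P₁ P₂ : List (Fin n)) → IsPath P₁ × IsPath P₂ ×
      ((u v : Fin n) → u ≢ v →
        (pathHasEdge P₁ u v xor pathHasEdge P₂ u v) ≡ swapEdges Cs a b c d u v)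
lemma3p9 n Cs disjointCycles a b c d _ c≢d ab∈ cd∉ a≢c a≢d b≢c b≢d with openCyclesAt Cs a b disjointCycles ab∈
... | q , R , refl , uniq , cycs , Cs≐ =
  let P₁ , P₂ , path₁ , path₂ , parity = twoPathCover b q R c d uniq cycs c≢d b≢c b≢d a≢c a≢d F-cd
  in P₁ , P₂ , path₁ , path₂ , λ u v _ →
    begin
      pathHasEdge P₁ u v xor pathHasEdge P₂ u v
    ≡⟨ cong₂ _xor_ (pathHasEdge≡walkParity P₁ (proj₁ path₁) u v) (pathHasEdge≡walkParity P₂ (proj₁ path₂) u v) ⟩
      walkParity P₁ u v xor walkParity P₂ u v
    ≡⟨ parity u v ⟩
      F u v xor sameEdge u v c d
    ≡⟨ cong (_xor sameEdge u v c d) (F≐ u v) ⟩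
      (cyclesHaveEdge Cs u v xor sameEdge u v a b) xor sameEdge u v c d
    ≡⟨ swapEdges-≐ Cs a b c d ab∈ cd∉ a≢c a≢d b≢c b≢d u v ⟨
      swapEdges Cs a b c d u v
    ∎
  where
  open ≡-Reasoning
  F = walkParity (b ∷ q) ⊕ closedWalksParity R
  F≐ : F ≐ cyclesHaveEdge Cs ⊕ edge a b
  F≐ u v = trans (solve 2 (λ f e → f := (f :+ e) :+ e) refl (F u v) (sameEdge u v a b))
                 (cong (_xor sameEdge u v a b) (sym (Cs≐ u v)))
  F-cd : F c d ≡ false
  F-cd = trans (F≐ c d) (cong₂ _xor_ cd∉ (sameEdge-≢ c d a b (a≢c ∘ sym) (b≢c ∘ sym)))
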